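{- Every rough disc is a nest; that is, for every integer $z\ge 1$, the rough disc of size $z$ has the minimum span among all sets of $z$ cells of the grid $\mathbb{Z}\times\mathbb{Z}$.
   Context: Cells of the grid $\mathbb{Z}\times\mathbb{Z}$ are unit squares; the distance between cells $(x,y)$ and $(x',y')$ is the Manhattan distance $|x-x'|+|y-y'|$. The span of a finite set of cells is the maximum distance between two of its cells; a nest of size $z$ is a set of $z$ cells with minimum span among all sets of $z$ cells. The disc of radius $r\ge 0$ with center $c$ is the set of all cells at distance at most $r$ from $c$; it has $z_r=2r^2+2r+1$ cells. For $z$ with $z_r\le z<z_{r+1}$, the rough disc of size $z$ is defined as follows: if $z=z_r$ it is the disc $D$ of radius $r$; otherwise, letting $F$ be the set of cells not in $D$ but adjacent to some cell of $D$, it is $D$ together with exactly $z-z_r$ cells of $F$, chosen starting from the North neighbor of the East-most cell of $D$ and proceeding counterclockwise around $D$. -}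

module Defs where

open import Data.Nat as ℕ using (ℕ; zero; suc; _≤_; _<_; _≤?_; _⊔_)
open import Data.Integer as ℤ using (ℤ; +_; -_; ∣_∣; _-_)
open import Data.Product using (_×_; _,_)
open import Data.List using (List; []; _∷_; _++_; map; concatMap; filter; upTo; take; foldr; length)

-- A cell of the grid ℤ × ℤ, given by its coordinates (x , y).
-- East = +x, North = +y.
Cell : Set
Cell = ℤ × ℤ

dist : Cell → Cell → ℕ
dist (x , y) (x' , y') = ∣ x - x' ∣ ℕ.+ ∣ y - y' ∣

span : List Cell → ℕ
span S = foldr _⊔_ 0 (concatMap (λ a → map (λ b → dist a b) S) S)

open import Data.List.Relation.Unary.Unique.Propositional using (Unique)
open import Relation.Binary.PropositionalEquality using (_≡_)

IsSetOfSize : ℕ → List Cell → Set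
IsSetOfSize z S = Unique S × length S ≡ z

IsNest : ℕ → List Cell → Set
IsNest z N = IsSetOfSize z N × (∀ (S : List Cell) → IsSetOfSize z S → span N ≤ span S)

zr : ℕ → ℕ
zr r = 2 ℕ.* r ℕ.* r ℕ.+ 2 ℕ.* r ℕ.+ 1

origin : Cell
origin = (+ 0 , + 0)

range : ℕ → List ℤ
range r = map (λ i → + i - + r) (upTo (2 ℕ.* r ℕ.+ 1))

box : ℕ → List Cell
box r = concatMap (λ x → map (λ y → (x , y)) (range r)) (range r)

disc : ℕ → List Cell
disc r = filter (λ c → dist origin c ≤? r) (box r)

-- The cells at distance exactly m ≥ 1 from the origin (for m = r + 1 this is
-- the set F of cells not in the disc of radius r but adjacent to it), listed
-- counterclockwise starting from (m-1, 1), the North neighbour of the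
-- East-most cell (r, 0) of the disc of radius r = m - 1.
ring : ℕ → List Cell
ring m =
     map (λ k → (+ m - + 1 - + k , + 1 ℤ.+ + k)) (upTo m)        -- (m-1,1) … (0,m)
  ++ map (λ j → (- + 1 - + j , + m - + 1 - + j)) (upTo m)        -- (-1,m-1) … (-m,0)
  ++ map (λ j → (+ 1 - + m ℤ.+ + j , - + 1 - + j)) (upTo m)      -- (1-m,-1) … (0,-m)
  ++ map (λ j → (+ 1 ℤ.+ + j , + 1 - + m ℤ.+ + j)) (upTo m)      -- (1,1-m) … (m,0)

-- The rough disc of size z, where r is the radius with z_r ≤ z < z_{r+1}:
-- the disc of radius r together with the first z - z_r cells of F in
-- counterclockwise order (for z = z_r this is just the disc).
roughDisc : (r z : ℕ) → List Cell
roughDisc r z = disc r ++ take (z ℕ.∸ zr r) (ring (suc r))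

module Submission where

-- In the rotated coordinates u = x + y and v = x - y, the distance of two cells is at least
-- |Δu| and |Δv|, and u ≡ v (mod 2). A set of span d therefore injects into one colour class
-- of a (d+1) × (d+1) checkerboard, so it has at most zr r cells if d = 2r and at most
-- zr r + 2r + 1 cells if d = 2r + 1. The rough disc of size zr r + k meets these bounds:
-- its span is at most 2r if k = 0, at most 2r + 1 while the added ring cells stay in the
-- open upper half-plane (k ≤ 2r + 1), and at most 2r + 2 in any case.

open import Defs
open import Data.Nat
  using (ℕ; zero; suc; _+_; _*_; _∸_; _≤_; _<_; z≤n; s≤s; s≤s⁻¹; z<s; s<s; NonZero; ⌊_/2⌋; parity)
open import Data.Nat.Properties
open import Data.Nat.DivMod using (_%_; m<n⇒m%n≡m; [m+kn]%n≡m%n)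
open import Data.Nat.Tactic.RingSolver using (solve-∀)
open import Algebra.Properties.CommutativeSemigroup +-commutativeSemigroup
  using () renaming (interchange to +-interchange)
open import Data.Parity.Base as ℙ using (0ℙ)
import Data.Parity.Properties as ℙ
open import Data.Integer as ℤ using (ℤ; +_; +0; -[1+_]; +[1+_]; -_; ∣_∣; _-_; _⊖_)
import Data.Integer.Properties as ℤ
import Data.Integer.Tactic.RingSolver as ℤ
open import Data.Fin as Fin using (toℕ; fromℕ<)
open import Data.Fin.Properties using (injective⇒≤; toℕ-fromℕ<; toℕ<n; toℕ-injective)
open import Data.List
  using (List; []; _∷_; [_]; _++_; map; concatMap; upTo; take; length; lookup; cartesianProduct)
open import Data.List.Properties
  using (++-assoc; ++-identityʳ; map-++; upTo-∷ʳ; foldr-forcesᵇ; foldr-preservesᵇ; take++drop≡id; take-take;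
         length-++; length-map; length-upTo; length-take)
open import Data.List.Relation.Unary.All as All using (All; []; _∷_)
import Data.List.Relation.Unary.All.Properties as All
open import Data.List.Relation.Unary.Any as Any using (here)
open import Data.List.Relation.Unary.AllPairs using ([]; _∷_)
open import Data.List.Relation.Unary.Unique.Propositional using (Unique)
import Data.List.Relation.Unary.Unique.Propositional.Properties as Unique
open import Data.List.Membership.Propositional using (_∈_)
open import Data.List.Membership.Propositional.Properties
open import Data.List.Membership.Setoid.Properties using (index-injective)
open import Data.List.Relation.Binary.Subset.Propositional using (_⊆_)
open import Data.Product using (_×_; _,_; proj₁; proj₂)
open import Data.Sum using (_⊎_; inj₁; inj₂)
open import Function using (_∘_)
open import Relation.Binary.PropositionalEquality
  using (_≡_; refl; sym; trans; cong; cong₂; subst; setoid; module ≡-Reasoning)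
open import Relation.Nullary using (yes; no; contradiction)

lookup-injective : ∀ {A : Set} {xs : List A} → Unique xs → ∀ i j → lookup xs i ≡ lookup xs j → i ≡ j
lookup-injective (_ ∷ _)    Fin.zero    Fin.zero    _  = refl
lookup-injective (x∉xs ∷ _) Fin.zero    (Fin.suc j) eq =
  contradiction eq (All.lookup x∉xs (∈-lookup j))
lookup-injective (x∉xs ∷ _) (Fin.suc i) Fin.zero    eq =
  contradiction (sym eq) (All.lookup x∉xs (∈-lookup i))
lookup-injective (_ ∷ xs!)  (Fin.suc i) (Fin.suc j) eq = cong Fin.suc (lookup-injective xs! i j eq)

Unique⇒length≤ : ∀ {A : Set} {xs : List A} {m} → Unique xs →
  (key : ∀ {a} → a ∈ xs → ℕ) → (∀ {a} (p : a ∈ xs) → key p < m) →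
  (∀ {a b} (p : a ∈ xs) (q : b ∈ xs) → key p ≡ key q → a ≡ b) → length xs ≤ m
Unique⇒length≤ xs! key key<m key-injective = injective⇒≤ {f = fin} λ {i} {j} eq →
  lookup-injective xs! i j (key-injective (∈-lookup i) (∈-lookup j) (toℕ-cong eq))
  where
  fin = λ i → fromℕ< (key<m (∈-lookup i))
  toℕ-cong : ∀ {i j} → fin i ≡ fin j → key (∈-lookup i) ≡ key (∈-lookup j)
  toℕ-cong {i} {j} eq = trans (sym (toℕ-fromℕ< _)) (trans (cong toℕ eq) (toℕ-fromℕ< _))

Unique∧⊆⇒length≤ : ∀ {A : Set} {xs ys : List A} → Unique xs → xs ⊆ ys → length xs ≤ length ys
Unique∧⊆⇒length≤ xs! xs⊆ys = Unique⇒length≤ xs! (λ p → toℕ (Any.index (xs⊆ys p))) (λ p → toℕ<n _)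
  (λ p q eq → index-injective (setoid _) (xs⊆ys p) (xs⊆ys q) (toℕ-injective eq))

take⊆ : ∀ {A : Set} k (xs : List A) → take k xs ⊆ xs
take⊆ k xs p = subst (_ ∈_) (take++drop≡id k xs) (∈-++⁺ˡ p)

take-mono-⊆ : ∀ {A : Set} {k k'} (xs : List A) → k ≤ k' → take k xs ⊆ take k' xs
take-mono-⊆ {k = k} {k'} xs k≤k' p = take⊆ k (take k' xs)
  (subst (_ ∈_) (trans (cong (λ n → take n xs) (sym (m≤n⇒m⊓n≡m k≤k'))) (sym (take-take k k' xs))) p)

take-length-++ : ∀ {A : Set} (xs ys : List A) → take (length xs) (xs ++ ys) ≡ xs
take-length-++ []       ys = refl
take-length-++ (x ∷ xs) ys = cong (x ∷_) (take-length-++ xs ys)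

⌊/2⌋-parity-injective : ∀ m n → ⌊ m /2⌋ ≡ ⌊ n /2⌋ → parity m ≡ parity n → m ≡ n
⌊/2⌋-parity-injective 0             0             _ _ = refl
⌊/2⌋-parity-injective 1             1             _ _ = refl
⌊/2⌋-parity-injective (suc (suc m)) (suc (suc n)) h p =
  cong (suc ∘ suc) (⌊/2⌋-parity-injective m n (suc-injective h) p)
⌊/2⌋-parity-injective 0             1             _ ()
⌊/2⌋-parity-injective 1             0             _ ()
⌊/2⌋-parity-injective 0             (suc (suc _)) () _
⌊/2⌋-parity-injective 1             (suc (suc _)) () _
⌊/2⌋-parity-injective (suc (suc _)) 0             () _
⌊/2⌋-parity-injective (suc (suc _)) 1             () _

parity[n+n]≡0ℙ : ∀ n → parity (n + n) ≡ 0ℙ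
parity[n+n]≡0ℙ n = trans (ℙ.+-homo-+ n n) (ℙ.p+p≡0ℙ (parity n))

parity[m+[n+n]]≡parity[m] : ∀ m n → parity (m + (n + n)) ≡ parity m
parity[m+[n+n]]≡parity[m] m n = begin
  parity (m + (n + n))         ≡⟨ ℙ.+-homo-+ m (n + n) ⟩
  parity m ℙ.+ parity (n + n)  ≡⟨ cong (parity m ℙ.+_) (parity[n+n]≡0ℙ n) ⟩
  parity m ℙ.+ 0ℙ              ≡⟨ ℙ.+-identityʳ (parity m) ⟩
  parity m                     ∎
  where open ≡-Reasoning

parity[m*[1+n+n]]≡parity[m] : ∀ m n → parity (m * suc (n + n)) ≡ parity m
parity[m*[1+n+n]]≡parity[m] m n = begin
  parity (m * suc (n + n))            ≡⟨ ℙ.*-homo-* m (suc (n + n)) ⟩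
  parity m ℙ.* parity (1 + (n + n))   ≡⟨ cong (λ p → parity m ℙ.* p) (ℙ.+-homo-+ 1 (n + n)) ⟩
  parity m ℙ.* (ℙ.1ℙ ℙ.+ parity (n + n))
    ≡⟨ cong (λ p → parity m ℙ.* (ℙ.1ℙ ℙ.+ p)) (parity[n+n]≡0ℙ n) ⟩
  parity m ℙ.* ℙ.1ℙ                   ≡⟨ ℙ.*-identityʳ (parity m) ⟩
  parity m                            ∎
  where open ≡-Reasoning

+m≡+n+[δ+δ]⇒parity≡ : ∀ {m n} δ → + m ≡ + n ℤ.+ (δ ℤ.+ δ) → parity m ≡ parity n
+m≡+n+[δ+δ]⇒parity≡ {n = n} (+ k) eq =
  trans (cong parity (ℤ.+-injective eq)) (parity[m+[n+n]]≡parity[m] n k)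
+m≡+n+[δ+δ]⇒parity≡ {n = n} -[1+ k ] eq = sym (+m≡+n+[δ+δ]⇒parity≡ (+ suc k)
  (trans (undo-gap (+ n) -[1+ k ]) (cong (ℤ._+ _) (sym eq))))
  where
  undo-gap : ∀ j δ → j ≡ (j ℤ.+ (δ ℤ.+ δ)) ℤ.+ (- δ ℤ.+ - δ)
  undo-gap = ℤ.solve-∀

digits-injective : ∀ {n a a' b b'} .{{_ : NonZero n}} → b < n → b' < n →
  b + a * n ≡ b' + a' * n → b ≡ b' × a ≡ a'
digits-injective {n} {a} {a'} {b} {b'} b<n b'<n eq =
  b≡b' , *-cancelʳ-≡ a a' n (+-cancelˡ-≡ b _ _ (trans eq (cong (_+ a' * n) (sym b≡b'))))
  where
  open ≡-Reasoning
  b≡b' : b ≡ b'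
  b≡b' = begin
    b                  ≡⟨ m<n⇒m%n≡m b<n ⟨
    b % n              ≡⟨ [m+kn]%n≡m%n b a n ⟨
    (b + a * n) % n    ≡⟨ cong (_% n) eq ⟩
    (b' + a' * n) % n  ≡⟨ [m+kn]%n≡m%n b' a' n ⟩
    b' % n             ≡⟨ m<n⇒m%n≡m b'<n ⟩
    b'                 ∎

dist≤span : ∀ {S a b} → a ∈ S → b ∈ S → dist a b ≤ span S
dist≤span {S} {a} {b} a∈S b∈S = All.lookup
  (foldr-forcesᵇ {P = _≤ span S} (λ m n m⊔n≤ → m⊔n≤o⇒m≤o m n m⊔n≤ , m⊔n≤o⇒n≤o m n m⊔n≤) 0 _ ≤-refl)
  (∈-concatMap⁺ (λ a → map (dist a) S) (Any.map (λ { refl → ∈-map⁺ (dist a) b∈S }) a∈S))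

span≤ : ∀ {S d} → (∀ {a b} → a ∈ S → b ∈ S → dist a b ≤ d) → span S ≤ d
span≤ {S} {d} dist≤d = foldr-preservesᵇ {P = _≤ d} ⊔-lub z≤n
  (All.concat⁺ (All.map⁺ (All.tabulate λ a∈S → All.map⁺ (All.tabulate λ b∈S → dist≤d a∈S b∈S))))

module Checkerboard {A : Set} {S : List A} (S! : Unique S) (U V : A → ℕ)
  (UV-injective : ∀ {s t} → s ∈ S → t ∈ S → U s ≡ U t → V s ≡ V t → s ≡ t)
  (parity-UV : ∀ {s t} → s ∈ S → t ∈ S → parity (U s + V s) ≡ parity (U t + V t)) where

  -- code s < (2r+1)² has the parity of U s + V s, so halving it keeps it injective.
  length≤zr : ∀ r → (∀ {s} → s ∈ S → U s ≤ r + r) → (∀ {s} → s ∈ S → V s ≤ r + r) →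
    length S ≤ zr r
  length≤zr r U≤ V≤ = Unique⇒length≤ S! (λ {s} _ → ⌊ code s /2⌋) key<zr key-injective
    where
    D = suc (r + r)
    code : A → ℕ
    code s = V s + U s * D
    parity-code : ∀ s → parity (code s) ≡ parity (U s + V s)
    parity-code s = begin
      parity (V s + U s * D)             ≡⟨ ℙ.+-homo-+ (V s) (U s * D) ⟩
      parity (V s) ℙ.+ parity (U s * D)
        ≡⟨ cong (parity (V s) ℙ.+_) (parity[m*[1+n+n]]≡parity[m] (U s) r) ⟩
      parity (V s) ℙ.+ parity (U s)      ≡⟨ ℙ.+-comm (parity (V s)) (parity (U s)) ⟩
      parity (U s) ℙ.+ parity (V s)      ≡⟨ ℙ.+-homo-+ (U s) (V s) ⟨
      parity (U s + V s)                 ∎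
      where open ≡-Reasoning
    key-injective : ∀ {s t} (p : s ∈ S) (q : t ∈ S) → ⌊ code s /2⌋ ≡ ⌊ code t /2⌋ → s ≡ t
    key-injective {s} {t} p q eq with digits-injective (s≤s (V≤ p)) (s≤s (V≤ q))
      (⌊/2⌋-parity-injective (code s) (code t) eq
        (trans (parity-code s) (trans (parity-UV p q) (sym (parity-code t)))))
    ... | Vs≡Vt , Us≡Ut = UV-injective p q Us≡Ut Vs≡Vt
    key<zr : ∀ {s} → s ∈ S → ⌊ code s /2⌋ < zr r
    key<zr {s} p = begin-strict
      ⌊ code s /2⌋                 ≤⟨ ⌊n/2⌋-mono (+-mono-≤ (V≤ p) (*-monoˡ-≤ D (U≤ p))) ⟩
      ⌊ (r + r) + (r + r) * D /2⌋  ≡⟨ cong ⌊_/2⌋ (max-code r) ⟩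
      ⌊ M r + M r /2⌋              ≡⟨ n≡⌊n+n/2⌋ (M r) ⟨
      M r                          <⟨ n<1+n (M r) ⟩
      suc (M r)                    ≡⟨ zr≡1+M r ⟨
      zr r                         ∎
      where
      open ≤-Reasoning
      M : ℕ → ℕ
      M r = r * (r + r) + (r + r)
      max-code : ∀ r → (r + r) + (r + r) * suc (r + r)
                     ≡ (r * (r + r) + (r + r)) + (r * (r + r) + (r + r))
      max-code = solve-∀
      zr≡1+M : ∀ r → 2 * r * r + 2 * r + 1 ≡ suc (r * (r + r) + (r + r))
      zr≡1+M = solve-∀

  -- key s encodes (U s , ⌊V s/2⌋); the last bit of V s is recovered from the parity of U s + V s.
  length≤zr+1+2r : ∀ r → (∀ {s} → s ∈ S → U s ≤ suc (r + r)) → (∀ {s} → s ∈ S → V s ≤ suc (r + r)) →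
    length S ≤ zr r + suc (r + r)
  length≤zr+1+2r r U≤ V≤ = Unique⇒length≤ S! (λ {s} _ → key s) key< key-injective
    where
    key : A → ℕ
    key s = ⌊ V s /2⌋ + U s * suc r
    ⌊V/2⌋≤r : ∀ {s} → s ∈ S → ⌊ V s /2⌋ ≤ r
    ⌊V/2⌋≤r p = ≤-trans (⌊n/2⌋-mono (V≤ p)) (≤-reflexive (sym (n≡⌈n+n/2⌉ r)))
    key-injective : ∀ {s t} (p : s ∈ S) (q : t ∈ S) → key s ≡ key t → s ≡ t
    key-injective {s} {t} p q eq with digits-injective (s≤s (⌊V/2⌋≤r p)) (s≤s (⌊V/2⌋≤r q)) eq
    ... | ⌊Vs/2⌋≡⌊Vt/2⌋ , Us≡Ut = UV-injective p q Us≡Ut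
      (⌊/2⌋-parity-injective (V s) (V t) ⌊Vs/2⌋≡⌊Vt/2⌋ (ℙ.+-cancelˡ-≡ (parity (U s)) _ _ (begin
        parity (U s) ℙ.+ parity (V s)  ≡⟨ ℙ.+-homo-+ (U s) (V s) ⟨
        parity (U s + V s)             ≡⟨ parity-UV p q ⟩
        parity (U t + V t)             ≡⟨ ℙ.+-homo-+ (U t) (V t) ⟩
        parity (U t) ℙ.+ parity (V t)  ≡⟨ cong (λ u → parity u ℙ.+ parity (V t)) Us≡Ut ⟨
        parity (U s) ℙ.+ parity (V t)  ∎)))
      where open ≡-Reasoning
    key< : ∀ {s} → s ∈ S → key s < zr r + suc (r + r)
    key< {s} p = begin-strict
      key s                          ≤⟨ +-mono-≤ (⌊V/2⌋≤r p) (*-monoˡ-≤ (suc r) (U≤ p)) ⟩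
      r + suc (r + r) * suc r        <⟨ n<1+n _ ⟩
      suc (r + suc (r + r) * suc r)  ≡⟨ max-key r ⟩
      zr r + suc (r + r)             ∎
      where
      open ≤-Reasoning
      max-key : ∀ r → suc (r + suc (r + r) * suc r) ≡ (2 * r * r + 2 * r + 1) + suc (r + r)
      max-key = solve-∀

i-k≡j-k⇒i≡j : ∀ {i j} k → i - k ≡ j - k → i ≡ j
i-k≡j-k⇒i≡j {i} {j} k eq = trans (sym (i-k+k i k)) (trans (cong (ℤ._+ k) eq) (i-k+k j k))
  where
  i-k+k : ∀ i k → (i - k) ℤ.+ k ≡ i
  i-k+k = ℤ.solve-∀

u v : Cell → ℤ
u (x , y) = x ℤ.+ y
v (x , y) = x - y

∣Δu∣≤dist : ∀ s t → ∣ u s - u t ∣ ≤ dist s t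
∣Δu∣≤dist (x , y) (x' , y') = subst (λ i → ∣ i ∣ ≤ dist (x , y) (x' , y')) (sym (Δu x y x' y'))
  (ℤ.∣i+j∣≤∣i∣+∣j∣ (x - x') (y - y'))
  where
  Δu : ∀ x y x' y' → (x ℤ.+ y) - (x' ℤ.+ y') ≡ (x - x') ℤ.+ (y - y')
  Δu = ℤ.solve-∀

∣Δv∣≤dist : ∀ s t → ∣ v s - v t ∣ ≤ dist s t
∣Δv∣≤dist (x , y) (x' , y') = subst (λ i → ∣ i ∣ ≤ dist (x , y) (x' , y')) (sym (Δv x y x' y'))
  (ℤ.∣i-j∣≤∣i∣+∣j∣ (x - x') (y - y'))
  where
  Δv : ∀ x y x' y' → (x - y) - (x' - y') ≡ (x - x') - (y - y')
  Δv = ℤ.solve-∀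

uv-injective : ∀ {s t} → u s ≡ u t → v s ≡ v t → s ≡ t
uv-injective {x , y} {x' , y'} us≡ut vs≡vt = cong₂ _,_
  (ℤ.*-cancelˡ-≡ (+ 2) x x' (trans (sym (u+v x y)) (trans (cong₂ ℤ._+_ us≡ut vs≡vt) (u+v x' y'))))
  (ℤ.*-cancelˡ-≡ (+ 2) y y' (trans (sym (u-v x y)) (trans (cong₂ _-_ us≡ut vs≡vt) (u-v x' y'))))
  where
  u+v : ∀ x y → (x ℤ.+ y) ℤ.+ (x - y) ≡ + 2 ℤ.* x
  u+v = ℤ.solve-∀
  u-v : ∀ x y → (x ℤ.+ y) - (x - y) ≡ + 2 ℤ.* y
  u-v = ℤ.solve-∀

module Rotated (S : List Cell) {c : Cell} (c∈S : c ∈ S) where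

  open import Data.List.Extrema ℤ.≤-totalOrder using (argmin; f[argmin]≤f[xs]; argmin-all)

  U V : Cell → ℕ
  U s = ∣ u s - u (argmin u c S) ∣
  V s = ∣ v s - v (argmin v c S) ∣

  private
    argmin∈S : ∀ f → argmin f c S ∈ S
    argmin∈S f = argmin-all f {P = _∈ S} c∈S (All.tabulate (λ p → p))

    +∣f-min∣ : ∀ f {s} → s ∈ S → + ∣ f s - f (argmin f c S) ∣ ≡ f s - f (argmin f c S)
    +∣f-min∣ f p = ℤ.0≤i⇒+∣i∣≡i (ℤ.i≤j⇒0≤j-i (All.lookup (f[argmin]≤f[xs] {f = f} c S) p))

  U≤span : ∀ {s} → s ∈ S → U s ≤ span S
  U≤span {s} p = ≤-trans (∣Δu∣≤dist s _) (dist≤span p (argmin∈S u))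

  V≤span : ∀ {s} → s ∈ S → V s ≤ span S
  V≤span {s} p = ≤-trans (∣Δv∣≤dist s _) (dist≤span p (argmin∈S v))

  UV-injective : ∀ {s t} → s ∈ S → t ∈ S → U s ≡ U t → V s ≡ V t → s ≡ t
  UV-injective p q Us≡Ut Vs≡Vt = uv-injective
    (i-k≡j-k⇒i≡j _ (trans (sym (+∣f-min∣ u p)) (trans (cong +_ Us≡Ut) (+∣f-min∣ u q))))
    (i-k≡j-k⇒i≡j _ (trans (sym (+∣f-min∣ v p)) (trans (cong +_ Vs≡Vt) (+∣f-min∣ v q))))

  -- U + V is 2x up to a shift common to all cells.
  parity-UV : ∀ {s t} → s ∈ S → t ∈ S → parity (U s + V s) ≡ parity (U t + V t)
  parity-UV {s@(x , y)} {t@(x' , y')} p q = +m≡+n+[δ+δ]⇒parity≡ (x - x') (begin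
    + U s ℤ.+ + V s                              ≡⟨ cong₂ ℤ._+_ (+∣f-min∣ u p) (+∣f-min∣ v p) ⟩
    (u s - a) ℤ.+ (v s - b)                      ≡⟨ shift x y x' y' a b ⟩
    ((u t - a) ℤ.+ (v t - b)) ℤ.+ ((x - x') ℤ.+ (x - x'))
      ≡⟨ cong (ℤ._+ ((x - x') ℤ.+ (x - x'))) (cong₂ ℤ._+_ (+∣f-min∣ u q) (+∣f-min∣ v q)) ⟨
    (+ U t ℤ.+ + V t) ℤ.+ ((x - x') ℤ.+ (x - x')) ∎)
    where
    open ≡-Reasoning
    a = u (argmin u c S)
    b = v (argmin v c S)
    shift : ∀ x y x' y' a b → ((x ℤ.+ y) - a) ℤ.+ ((x - y) - b)
                            ≡ (((x' ℤ.+ y') - a) ℤ.+ ((x' - y') - b)) ℤ.+ ((x - x') ℤ.+ (x - x'))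
    shift = ℤ.solve-∀

span≤2r⇒length≤zr : ∀ r {S} → Unique S → span S ≤ r + r → length S ≤ zr r
span≤2r⇒length≤zr r {[]}    _  _      = z≤n
span≤2r⇒length≤zr r {c ∷ S} S! span≤d =
  length≤zr r (λ p → ≤-trans (U≤span p) span≤d) (λ p → ≤-trans (V≤span p) span≤d)
  where
  open Rotated (c ∷ S) (here refl)
  open Checkerboard S! U V UV-injective parity-UV

span≤1+2r⇒length≤zr+1+2r : ∀ r {S} → Unique S → span S ≤ suc (r + r) →
  length S ≤ zr r + suc (r + r)
span≤1+2r⇒length≤zr+1+2r r {[]}    _  _      = z≤n
span≤1+2r⇒length≤zr+1+2r r {c ∷ S} S! span≤d =
  length≤zr+1+2r r (λ p → ≤-trans (U≤span p) span≤d) (λ p → ≤-trans (V≤span p) span≤d)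
  where
  open Rotated (c ∷ S) (here refl)
  open Checkerboard S! U V UV-injective parity-UV

norm : Cell → ℕ
norm (x , y) = ∣ x ∣ + ∣ y ∣

dist-origin : ∀ c → dist origin c ≡ norm c
dist-origin (x , y) = cong₂ _+_ (∣0-i∣≡∣i∣ x) (∣0-i∣≡∣i∣ y)
  where
  ∣0-i∣≡∣i∣ : ∀ i → ∣ + 0 - i ∣ ≡ ∣ i ∣
  ∣0-i∣≡∣i∣ i = trans (cong ∣_∣ (ℤ.+-identityˡ (- i))) (ℤ.∣-i∣≡∣i∣ i)

dist≤norm+norm : ∀ a b → dist a b ≤ norm a + norm b
dist≤norm+norm (x , y) (x' , y') = begin
  ∣ x - x' ∣ + ∣ y - y' ∣          ≤⟨ +-mono-≤ (ℤ.∣i-j∣≤∣i∣+∣j∣ x x') (ℤ.∣i-j∣≤∣i∣+∣j∣ y y') ⟩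
  (∣ x ∣ + ∣ x' ∣) + (∣ y ∣ + ∣ y' ∣) ≡⟨ +-interchange (∣ x ∣) (∣ x' ∣) (∣ y ∣) (∣ y' ∣) ⟩
  (∣ x ∣ + ∣ y ∣) + (∣ x' ∣ + ∣ y' ∣) ∎
  where open ≤-Reasoning

span≤ρ+ρ : ∀ {S ρ} → (∀ {c} → c ∈ S → norm c ≤ ρ) → span S ≤ ρ + ρ
span≤ρ+ρ norm≤ρ = span≤ λ {a} {b} p q → ≤-trans (dist≤norm+norm a b) (+-mono-≤ (norm≤ρ p) (norm≤ρ q))

box≡cartesianProduct : ∀ r → box r ≡ cartesianProduct (range r) (range r)
box≡cartesianProduct r = go (range r)
  where
  go : ∀ xs → concatMap (λ x → map (x ,_) (range r)) xs ≡ cartesianProduct xs (range r)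
  go []       = refl
  go (x ∷ xs) = cong (map (x ,_) (range r) ++_) (go xs)

∣x∣≤r⇒x∈range : ∀ r {x} → ∣ x ∣ ≤ r → x ∈ range r
∣x∣≤r⇒x∈range r {x} ∣x∣≤r = subst (_∈ range r) (index-r≡x x ∣x∣≤r)
  (∈-map⁺ (λ i → + i - + r) (∈-upTo⁺ (subst (index x <_) (1+r+r≡2r+1 r) (s≤s (index≤r+r x ∣x∣≤r)))))
  where
  i+j-j≡i : ∀ i j → (i ℤ.+ j) - j ≡ i
  i+j-j≡i = ℤ.solve-∀
  i-[i+j]≡-j : ∀ i j → i - (i ℤ.+ j) ≡ - j
  i-[i+j]≡-j = ℤ.solve-∀
  1+r+r≡2r+1 : ∀ r → suc (r + r) ≡ 2 * r + 1
  1+r+r≡2r+1 = solve-∀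
  index : ℤ → ℕ
  index (+ m)    = m + r
  index -[1+ m ] = r ∸ suc m
  index≤r+r : ∀ x → ∣ x ∣ ≤ r → index x ≤ r + r
  index≤r+r (+ m)    m≤r = +-monoˡ-≤ r m≤r
  index≤r+r -[1+ m ] _   = ≤-trans (m∸n≤m r (suc m)) (m≤m+n r r)
  index-r≡x : ∀ x → ∣ x ∣ ≤ r → + index x - + r ≡ x
  index-r≡x (+ m)    _     = i+j-j≡i (+ m) (+ r)
  index-r≡x -[1+ m ] 1+m≤r = trans (cong (λ n → + (r ∸ suc m) - + n) (sym (m∸n+n≡m 1+m≤r)))
                                   (i-[i+j]≡-j (+ (r ∸ suc m)) (+ suc m))

disc-unique : ∀ r → Unique (disc r)
disc-unique r = Unique.filter⁺ _ (subst Unique (sym (box≡cartesianProduct r))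
  (Unique.cartesianProduct⁺ range-unique range-unique))
  where
  range-unique : Unique (range r)
  range-unique = Unique.map⁺ (λ eq → ℤ.+-injective (i-k≡j-k⇒i≡j (+ r) eq)) (Unique.upTo⁺ _)

∈disc⇒norm≤ : ∀ r {c} → c ∈ disc r → norm c ≤ r
∈disc⇒norm≤ r {c} p =
  subst (_≤ r) (dist-origin c) (proj₂ (∈-filter⁻ (λ c → dist origin c ≤? r) {xs = box r} p))

norm≤⇒∈disc : ∀ r {c} → norm c ≤ r → c ∈ disc r
norm≤⇒∈disc r {c@(x , y)} norm≤r = ∈-filter⁺ (λ c → dist origin c ≤? r)
  (subst (c ∈_) (sym (box≡cartesianProduct r)) (∈-cartesianProduct⁺
    (∣x∣≤r⇒x∈range r (≤-trans (m≤m+n (∣ x ∣) (∣ y ∣)) norm≤r))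
    (∣x∣≤r⇒x∈range r (≤-trans (m≤n+m (∣ y ∣) (∣ x ∣)) norm≤r))))
  (subst (_≤ r) (sym (dist-origin c)) norm≤r)

-- The four arcs of ring m, written exactly as in its definition, so that ring m unfolds
-- to their concatenation.
arcNE arcNW arcSW arcSE : ℕ → ℕ → Cell
arcNE m k = (+ m - + 1 - + k , + 1 ℤ.+ + k)
arcNW m j = (- + 1 - + j , + m - + 1 - + j)
arcSW m j = (+ 1 - + m ℤ.+ + j , - + 1 - + j)
arcSE m j = (+ 1 ℤ.+ + j , + 1 - + m ℤ.+ + j)

-1-j≡-[1+j] : ∀ j → - + 1 - + j ≡ -[1+ j ]
-1-j≡-[1+j] zero    = refl
-1-j≡-[1+j] (suc j) = refl

+n-+k≡+[n∸k] : ∀ {n k} → k ≤ n → + n - + k ≡ + (n ∸ k)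
+n-+k≡+[n∸k] {n} {k} k≤n = trans (ℤ.m-n≡m⊖n n k) (ℤ.⊖-≥ k≤n)

1-[1+n]+j≡-[n∸j] : ∀ {n j} → j ≤ n → + 1 - + suc n ℤ.+ + j ≡ - + (n ∸ j)
1-[1+n]+j≡-[n∸j] {n} {j} j≤n = trans (shape (+ n) (+ j)) (cong -_ (+n-+k≡+[n∸k] j≤n))
  where
  shape : ∀ n j → + 1 - (+ 1 ℤ.+ n) ℤ.+ j ≡ - (n - j)
  shape = ℤ.solve-∀

-- Half-open quadrants numbered counterclockwise; the arcs of a ring lie in quadrants 0, 1, 2, 3.
quadrant : Cell → ℕ
quadrant (+ _      , +[1+ _ ]) = 0
quadrant (-[1+ _ ] , + _)      = 1
quadrant (+0       , -[1+ _ ]) = 2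
quadrant (-[1+ _ ] , -[1+ _ ]) = 2
quadrant (+[1+ _ ] , +0)       = 3
quadrant (+[1+ _ ] , -[1+ _ ]) = 3
quadrant (+0       , +0)       = 0

All-map-upTo : ∀ {P : Cell → Set} {f : ℕ → Cell} {m} → (∀ {k} → k < m → P (f k)) →
  All P (map f (upTo m))
All-map-upTo Pf = All.map⁺ (All.tabulate (λ k∈upTo → Pf (∈-upTo⁻ k∈upTo)))

OnRing : ℕ → ℕ → Cell → Set
OnRing n i c = norm c ≡ suc n × quadrant c ≡ i

arcNE-onRing : ∀ n → All (OnRing n 0) (map (arcNE (suc n)) (upTo (suc n)))
arcNE-onRing n = All-map-upTo λ {k} k<1+n → let k≤n = s≤s⁻¹ k<1+n in
  subst (OnRing n 0) (sym (cong (_, +[1+ k ]) (+n-+k≡+[n∸k] k≤n)))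
    (trans (+-suc (n ∸ k) k) (cong suc (m∸n+n≡m k≤n)) , refl)

arcNW-onRing : ∀ n → All (OnRing n 1) (map (arcNW (suc n)) (upTo (suc n)))
arcNW-onRing n = All-map-upTo λ {j} j<1+n → let j≤n = s≤s⁻¹ j<1+n in
  subst (OnRing n 1) (sym (cong₂ _,_ (-1-j≡-[1+j] j) (+n-+k≡+[n∸k] j≤n)))
    (cong suc (m+[n∸m]≡n j≤n) , refl)

arcSW-onRing : ∀ n → All (OnRing n 2) (map (arcSW (suc n)) (upTo (suc n)))
arcSW-onRing n = All-map-upTo λ {j} j<1+n → let j≤n = s≤s⁻¹ j<1+n in
  subst (OnRing n 2) (sym (cong₂ _,_ (1-[1+n]+j≡-[n∸j] j≤n) (-1-j≡-[1+j] j)))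
    (trans (cong (_+ suc j) (ℤ.∣-i∣≡∣i∣ (+ (n ∸ j))))
           (trans (+-suc (n ∸ j) j) (cong suc (m∸n+n≡m j≤n))) ,
     quadrant-SW (n ∸ j) j)
  where
  quadrant-SW : ∀ a j → quadrant (- + a , -[1+ j ]) ≡ 2
  quadrant-SW zero    j = refl
  quadrant-SW (suc a) j = refl

arcSE-onRing : ∀ n → All (OnRing n 3) (map (arcSE (suc n)) (upTo (suc n)))
arcSE-onRing n = All-map-upTo λ {j} j<1+n → let j≤n = s≤s⁻¹ j<1+n in
  subst (OnRing n 3) (sym (cong (+[1+ j ] ,_) (1-[1+n]+j≡-[n∸j] j≤n)))
    (trans (cong (λ a → suc j + a) (ℤ.∣-i∣≡∣i∣ (+ (n ∸ j)))) (cong suc (m+[n∸m]≡n j≤n)) ,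
     quadrant-SE (n ∸ j) j)
  where
  quadrant-SE : ∀ a j → quadrant (+[1+ j ] , - + a) ≡ 3
  quadrant-SE zero    j = refl
  quadrant-SE (suc a) j = refl

ring-norm : ∀ n → All (λ c → norm c ≡ suc n) (ring (suc n))
ring-norm n = All.++⁺ (All.map proj₁ (arcNE-onRing n)) (All.++⁺ (All.map proj₁ (arcNW-onRing n))
  (All.++⁺ (All.map proj₁ (arcSW-onRing n)) (All.map proj₁ (arcSE-onRing n))))

Unique-++⁺-separated : ∀ {A : Set} (f : A → ℕ) {i} {xs ys : List A} → Unique xs →
  All (λ a → f a ≡ i) xs → All (λ b → i < f b) ys → Unique ys → Unique (xs ++ ys)
Unique-++⁺-separated f xs! f≡i i<f ys! =
  Unique.++⁺ xs! ys! λ (p , q) → <-irrefl (sym (All.lookup f≡i p)) (All.lookup i<f q)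

arc-injective : ∀ (f : ℕ → Cell) (coord : Cell → ℤ) → (∀ j → ∣ coord (f j) ∣ ≡ suc j) →
  ∀ {j j'} → f j ≡ f j' → j ≡ j'
arc-injective f coord ∣coord∣≡ {j} {j'} eq =
  suc-injective (trans (sym (∣coord∣≡ j)) (trans (cong (∣_∣ ∘ coord) eq) (∣coord∣≡ j')))

ring-unique : ∀ n → Unique (ring (suc n))
ring-unique n =
  separated (arc! (arcNE m) proj₂ λ _ → refl) (quadrants NE)
    (All.++⁺ (above z<s NW) (All.++⁺ (above z<s SW) (above z<s SE))) (
  separated (arc! (arcNW m) proj₁ (cong ∣_∣ ∘ -1-j≡-[1+j])) (quadrants NW)
    (All.++⁺ (above (s<s z<s) SW) (above (s<s z<s) SE)) (
  separated (arc! (arcSW m) proj₂ (cong ∣_∣ ∘ -1-j≡-[1+j])) (quadrants SW)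
    (above (s<s (s<s z<s)) SE)
  (arc! (arcSE m) proj₁ λ _ → refl)))
  where
  m = suc n
  NE = arcNE-onRing n
  NW = arcNW-onRing n
  SW = arcSW-onRing n
  SE = arcSE-onRing n
  separated = Unique-++⁺-separated quadrant
  arc! : ∀ f coord → (∀ j → ∣ coord (f j) ∣ ≡ suc j) → Unique (map f (upTo m))
  arc! f coord ∣coord∣≡ = Unique.map⁺ (arc-injective f coord ∣coord∣≡) (Unique.upTo⁺ m)
  quadrants : ∀ {i xs} → All (OnRing n i) xs → All (λ c → quadrant c ≡ i) xs
  quadrants = All.map proj₂
  above : ∀ {i j xs} → i < j → All (OnRing n j) xs → All (λ c → i < quadrant c) xs
  above i<j = All.map λ (_ , q≡j) → subst (_ <_) (sym q≡j) i<j

length-ring : ∀ m → length (ring m) ≡ m + (m + (m + m))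
length-ring m =
  trans (length-++ (arc (arcNE m))) (cong₂ _+_ (length-arc (arcNE m))
  (trans (length-++ (arc (arcNW m))) (cong₂ _+_ (length-arc (arcNW m))
  (trans (length-++ (arc (arcSW m))) (cong₂ _+_ (length-arc (arcSW m)) (length-arc (arcSE m)))))))
  where
  arc : (ℕ → Cell) → List Cell
  arc f = map f (upTo m)
  length-arc : ∀ f → length (arc f) ≡ m
  length-arc f = trans (length-map f (upTo m)) (length-upTo m)

ring-prefix : ∀ r → take (suc (r + r)) (ring (suc r))
                  ≡ map (arcNE (suc r)) (upTo (suc r)) ++ map (arcNW (suc r)) (upTo r)
ring-prefix r = begin
  take (suc (r + r)) (ring m)            ≡⟨ cong₂ take (sym length-prefix) ring≡prefix++rest ⟩
  take (length prefix) (prefix ++ rest)  ≡⟨ take-length-++ prefix rest ⟩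
  prefix                                 ∎
  where
  open ≡-Reasoning
  m = suc r
  NE = map (arcNE m) (upTo m)
  NW = map (arcNW m) (upTo r)
  SW++SE = map (arcSW m) (upTo m) ++ map (arcSE m) (upTo m)
  prefix = NE ++ NW
  rest = arcNW m r ∷ SW++SE
  ring≡prefix++rest : ring m ≡ prefix ++ rest
  ring≡prefix++rest = begin
    NE ++ map (arcNW m) (upTo m) ++ SW++SE
      ≡⟨ cong (λ l → NE ++ map (arcNW m) l ++ SW++SE) (upTo-∷ʳ r) ⟨
    NE ++ map (arcNW m) (upTo r ++ [ r ]) ++ SW++SE
      ≡⟨ cong (λ l → NE ++ l ++ SW++SE) (map-++ (arcNW m) (upTo r) [ r ]) ⟩
    NE ++ (NW ++ [ arcNW m r ]) ++ SW++SE
      ≡⟨ cong (NE ++_) (++-assoc NW [ arcNW m r ] SW++SE) ⟩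
    NE ++ NW ++ rest
      ≡⟨ ++-assoc NE NW rest ⟨
    prefix ++ rest
      ∎
  length-prefix : length prefix ≡ suc (r + r)
  length-prefix = trans (length-++ NE) (cong₂ _+_
    (trans (length-map _ (upTo m)) (length-upTo m)) (trans (length-map _ (upTo r)) (length-upTo r)))

ring-prefix-upper : ∀ r {k} → k ≤ suc (r + r) →
  All (λ c → ℤ.0ℤ ℤ.< proj₂ c) (take k (ring (suc r)))
ring-prefix-upper r k≤1+2r = All.anti-mono (take-mono-⊆ (ring (suc r)) k≤1+2r)
  (subst (All _) (sym (ring-prefix r)) (All.++⁺
    (All-map-upTo {f = arcNE (suc r)} λ _ → ℤ.+<+ z<s)
    (All-map-upTo {f = arcNW (suc r)} λ j<r →
      subst (ℤ.0ℤ ℤ.<_) (sym (+n-+k≡+[n∸k] (<⇒≤ j<r))) (ℤ.+<+ (m<n⇒0<n∸m j<r)))))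

dist+2≤norm+norm : ∀ {a b} → ℤ.0ℤ ℤ.< proj₂ a → ℤ.0ℤ ℤ.< proj₂ b →
  dist a b + 2 ≤ norm a + norm b
dist+2≤norm+norm {_ , +0}      (ℤ.+<+ ()) _
dist+2≤norm+norm {_ , -[1+ _ ]} () _
dist+2≤norm+norm {_ , +[1+ _ ]} {_ , +0}       _ (ℤ.+<+ ())
dist+2≤norm+norm {_ , +[1+ _ ]} {_ , -[1+ _ ]} _ ()
dist+2≤norm+norm {x , +[1+ p ]} {x' , +[1+ q ]} _ _ = begin
  ∣ x - x' ∣ + ∣ suc p ⊖ suc q ∣ + 2    ≡⟨ +-assoc (∣ x - x' ∣) _ 2 ⟩
  ∣ x - x' ∣ + (∣ suc p ⊖ suc q ∣ + 2)  ≤⟨ +-mono-≤ (ℤ.∣i-j∣≤∣i∣+∣j∣ x x') ∣Δy∣+2≤ ⟩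
  (∣ x ∣ + ∣ x' ∣) + (suc p + suc q)    ≡⟨ +-interchange (∣ x ∣) (∣ x' ∣) (suc p) (suc q) ⟩
  (∣ x ∣ + suc p) + (∣ x' ∣ + suc q)    ∎
  where
  open ≤-Reasoning
  ∣Δy∣+2≤ : ∣ suc p ⊖ suc q ∣ + 2 ≤ suc p + suc q
  ∣Δy∣+2≤ = begin
    ∣ suc p ⊖ suc q ∣ + 2  ≡⟨ cong (λ i → ∣ i ∣ + 2) (ℤ.[1+m]⊖[1+n]≡m⊖n p q) ⟩
    ∣ p ⊖ q ∣ + 2          ≤⟨ +-monoˡ-≤ 2 (≤-trans (ℤ.∣m⊝n∣≤m⊔n p q) (m⊔n≤m+n p q)) ⟩
    p + q + 2              ≡⟨ p+q+2≡ p q ⟩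
    suc p + suc q          ∎
    where
    p+q+2≡ : ∀ p q → p + q + 2 ≡ suc p + suc q
    p+q+2≡ = solve-∀

Unique-++⁺-ring : ∀ r {xs ys} → Unique xs → All (λ c → norm c ≤ r) xs →
  Unique ys → ys ⊆ ring (suc r) → Unique (xs ++ ys)
Unique-++⁺-ring r xs! norm≤r ys! ys⊆ring = Unique.++⁺ xs! ys! λ (p , q) →
  <-irrefl (All.lookup (ring-norm r) (ys⊆ring q)) (s≤s (All.lookup norm≤r p))

zr[1+r]≡zr[r]+length-ring : ∀ r → zr (suc r) ≡ zr r + length (ring (suc r))
zr[1+r]≡zr[r]+length-ring r = trans (eq r) (cong (λ n → zr r + n) (sym (length-ring (suc r))))
  where
  eq : ∀ r → 2 * suc r * suc r + 2 * suc r + 1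
           ≡ (2 * r * r + 2 * r + 1) + (suc r + (suc r + (suc r + suc r)))
  eq = solve-∀

discByRings : ℕ → List Cell
discByRings zero    = origin ∷ []
discByRings (suc r) = discByRings r ++ ring (suc r)

discByRings-norm : ∀ r → All (λ c → norm c ≤ r) (discByRings r)
discByRings-norm zero    = z≤n ∷ []
discByRings-norm (suc r) =
  All.++⁺ (All.map m≤n⇒m≤1+n (discByRings-norm r)) (All.map ≤-reflexive (ring-norm r))

discByRings-unique : ∀ r → Unique (discByRings r)
discByRings-unique zero    = [] ∷ []
discByRings-unique (suc r) =
  Unique-++⁺-ring r (discByRings-unique r) (discByRings-norm r) (ring-unique r) (λ p → p)

length-discByRings : ∀ r → length (discByRings r) ≡ zr r
length-discByRings zero    = refl
length-discByRings (suc r) = begin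
  length (discByRings r ++ ring (suc r))          ≡⟨ length-++ (discByRings r) ⟩
  length (discByRings r) + length (ring (suc r))  ≡⟨ cong (_+ length (ring (suc r))) (length-discByRings r) ⟩
  zr r + length (ring (suc r))                    ≡⟨ zr[1+r]≡zr[r]+length-ring r ⟨
  zr (suc r)                                      ∎
  where open ≡-Reasoning

-- At most zr r cells because the disc has span 2r, at least zr r because it contains discByRings r.
length-disc : ∀ r → length (disc r) ≡ zr r
length-disc r = ≤-antisym
  (span≤2r⇒length≤zr r (disc-unique r) (span≤ρ+ρ (∈disc⇒norm≤ r)))
  (subst (_≤ length (disc r)) (length-discByRings r)
    (Unique∧⊆⇒length≤ (discByRings-unique r) (norm≤⇒∈disc r ∘ All.lookup (discByRings-norm r))))

roughDisc-unique : ∀ r z → Unique (roughDisc r z)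
roughDisc-unique r z = Unique-++⁺-ring r (disc-unique r) (All.tabulate (∈disc⇒norm≤ r))
  (Unique.take⁺ (z ∸ zr r) (ring-unique r)) (take⊆ (z ∸ zr r) (ring (suc r)))

length-roughDisc : ∀ r {z} → zr r ≤ z → z ≤ zr (suc r) → length (roughDisc r z) ≡ z
length-roughDisc r {z} zr≤z z≤zr[1+r] = begin
  length (disc r ++ take k (ring (suc r)))     ≡⟨ length-++ (disc r) ⟩
  length (disc r) + length (take k (ring (suc r)))
    ≡⟨ cong₂ _+_ (length-disc r) (trans (length-take k (ring (suc r))) (m≤n⇒m⊓n≡m k≤length-ring)) ⟩
  zr r + k                                     ≡⟨ m+[n∸m]≡n zr≤z ⟩
  z                                            ∎
  where
  open ≡-Reasoning
  k = z ∸ zr r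
  k≤length-ring : k ≤ length (ring (suc r))
  k≤length-ring = ≤-trans (∸-monoˡ-≤ (zr r) z≤zr[1+r])
    (≤-reflexive (trans (cong (_∸ zr r) (zr[1+r]≡zr[r]+length-ring r)) (m+n∸m≡n (zr r) _)))

span-disc : ∀ r → span (disc r ++ take 0 (ring (suc r))) ≤ r + r
span-disc r =
  subst (λ cs → span cs ≤ r + r) (sym (++-identityʳ (disc r))) (span≤ρ+ρ (∈disc⇒norm≤ r))

span-disc++ring : ∀ r k → span (disc r ++ take k (ring (suc r))) ≤ suc r + suc r
span-disc++ring r k = span≤ρ+ρ λ p → norm≤1+r (∈-++⁻ (disc r) p)
  where
  norm≤1+r : ∀ {c} → c ∈ disc r ⊎ c ∈ take k (ring (suc r)) → norm c ≤ suc r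
  norm≤1+r (inj₁ p) = m≤n⇒m≤1+n (∈disc⇒norm≤ r p)
  norm≤1+r (inj₂ q) = ≤-reflexive (All.lookup (ring-norm r) (take⊆ k _ q))

span-disc++ring-prefix : ∀ r {k} → k ≤ suc (r + r) →
  span (disc r ++ take k (ring (suc r))) ≤ suc (r + r)
span-disc++ring-prefix r {k} k≤1+2r =
  span≤ λ {a} {b} p q → bound (∈-++⁻ (disc r) p) (∈-++⁻ (disc r) q)
  where
  inner : ∀ {c} → c ∈ disc r → norm c ≤ r
  inner = ∈disc⇒norm≤ r
  outer : ∀ {c} → c ∈ take k (ring (suc r)) → norm c ≡ suc r
  outer q = All.lookup (ring-norm r) (take⊆ k _ q)
  bound : ∀ {a b} → a ∈ disc r ⊎ a ∈ take k (ring (suc r)) → b ∈ disc r ⊎ b ∈ take k (ring (suc r)) →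
    dist a b ≤ suc (r + r)
  bound {a} {b} (inj₁ p) (inj₁ q) =
    m≤n⇒m≤1+n (≤-trans (dist≤norm+norm a b) (+-mono-≤ (inner p) (inner q)))
  bound {a} {b} (inj₁ p) (inj₂ q) =
    ≤-trans (dist≤norm+norm a b)
      (≤-trans (+-mono-≤ (inner p) (≤-reflexive (outer q))) (≤-reflexive (+-suc r r)))
  bound {a} {b} (inj₂ p) (inj₁ q) =
    ≤-trans (dist≤norm+norm a b) (+-mono-≤ (≤-reflexive (outer p)) (inner q))
  bound {a} {b} (inj₂ p) (inj₂ q) = m≤n⇒m≤1+n (+-cancelʳ-≤ 2 (dist a b) (r + r) (begin
    dist a b + 2        ≤⟨ dist+2≤norm+norm {a} {b} (All.lookup upper p) (All.lookup upper q) ⟩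
    norm a + norm b     ≡⟨ cong₂ _+_ (outer p) (outer q) ⟩
    suc r + suc r       ≡⟨ 1+r+1+r≡r+r+2 r ⟩
    r + r + 2           ∎))
    where
    open ≤-Reasoning
    upper = ring-prefix-upper r k≤1+2r
    1+r+1+r≡r+r+2 : ∀ r → suc r + suc r ≡ r + r + 2
    1+r+1+r≡r+r+2 = solve-∀

zr≤length⇒2r≤span : ∀ r {S} → Unique S → zr r ≤ length S → r + r ≤ span S
zr≤length⇒2r≤span zero    _  _ = z≤n
zr≤length⇒2r≤span (suc r) {S} S! zr≤length =
  subst (_≤ span S) (sym (+-suc (suc r) r)) (≰⇒> λ span≤1+2r → <⇒≱ (≤-trans zr+1+2r<zr[1+r] zr≤length) (span≤1+2r⇒length≤zr+1+2r r S! span≤1+2r))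
  where
  zr+1+2r<zr[1+r] : zr r + suc (r + r) < zr (suc r)
  zr+1+2r<zr[1+r] = subst (zr r + suc (r + r) <_) (sym (eq r)) (m<m+n _ z<s)
    where
    eq : ∀ r → 2 * suc r * suc r + 2 * suc r + 1
             ≡ ((2 * r * r + 2 * r + 1) + suc (r + r)) + suc (suc (suc (r + r)))
    eq = solve-∀

zr<length⇒1+2r≤span : ∀ r {S} → Unique S → zr r < length S → suc (r + r) ≤ span S
zr<length⇒1+2r≤span r S! zr<length = ≰⇒> λ span≤2r → <⇒≱ zr<length (span≤2r⇒length≤zr r S! span≤2r)

zr+1+2r<length⇒2+2r≤span : ∀ r {S} → Unique S → zr r + suc (r + r) < length S → suc r + suc r ≤ span S
zr+1+2r<length⇒2+2r≤span r {S} S! zr+1+2r<length =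
  subst (_≤ span S) (sym (+-suc (suc r) r)) (≰⇒> λ span≤1+2r → <⇒≱ zr+1+2r<length (span≤1+2r⇒length≤zr+1+2r r S! span≤1+2r))

span-roughDisc-minimal : ∀ r k {S} → Unique S → length S ≡ zr r + k →
  span (disc r ++ take k (ring (suc r))) ≤ span S
span-roughDisc-minimal r zero S! |S|≡zr+0 = ≤-trans (span-disc r)
  (zr≤length⇒2r≤span r S! (≤-reflexive (sym (trans |S|≡zr+0 (+-identityʳ (zr r))))))
span-roughDisc-minimal r (suc k) S! |S|≡zr+k with suc k ≤? suc (r + r)
... | yes k≤1+2r = ≤-trans (span-disc++ring-prefix r k≤1+2r)
  (zr<length⇒1+2r≤span r S! (subst (zr r <_) (sym |S|≡zr+k) (m<m+n (zr r) z<s)))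
... | no  k≰1+2r = ≤-trans (span-disc++ring r (suc k))
  (zr+1+2r<length⇒2+2r≤span r S!
    (subst (zr r + suc (r + r) <_) (sym |S|≡zr+k) (+-monoʳ-< (zr r) (≰⇒> k≰1+2r))))

proposition1 : (z r : ℕ) → 1 ≤ z → zr r ≤ z → z < zr (suc r) → IsNest z (roughDisc r z)
-- The hypothesis 1 ≤ z is implied by zr r ≤ z.
proposition1 z r _ zr≤z z<zr[1+r] =
  (roughDisc-unique r z , length-roughDisc r zr≤z (<⇒≤ z<zr[1+r])) ,
  λ S (S! , |S|≡z) → span-roughDisc-minimal r (z ∸ zr r) S! (trans |S|≡z (sym (m+[n∸m]≡n zr≤z)))
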